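{- Let an instance of \textsc{Equitable Scheduling with Unit Processing Times} be given: $n$ clients, $m$ days, positive integer deadlines $d_{i,j}$ for $i\in\{1,\dots,n\}$, $j\in\{1,\dots,m\}$, all processing times equal to $1$, and an integer $k\in\{0,\dots,m\}$. Let $d^*_j=\max_{1\le i\le n} d_{i,j}$. Let $G$ be the undirected graph with vertex set $V\cup U\cup W$, where $V=\{v_{i,j}: 1\le i\le n, 1\le j\le m\}$, $U=\{u_{d,j}: 1\le j\le m, 1\le d\le d^*_j\}$, $W=\{w_{i,\ell}: 1\le i\le n, 1\le \ell\le m-k\}$, and where each $v_{i,j}$ is adjacent exactly to $w_{i,1},\dots,w_{i,m-k}$ and to $u_{1,j},\dots,u_{d_{i,j},j}$ (there are no other edges). Then $G$ has a matching of size $nm$ if and only if there exist schedules $\{\sigma_1,\dots,\sigma_m\}$ under which no client is unsatisfied on more than $m-k$ days.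
   Context: A schedule for day $j$ is a permutation $\sigma_j:\{1,\dots,n\}\to\{1,\dots,n\}$ giving the order in which the jobs of day $j$ are processed non-preemptively on a single machine. With unit processing times, the completion time of the job of client $i$ on day $j$ is $C_{i,j}=\sigma_j(i)$. Client $i$ is satisfied on day $j$ if $C_{i,j}\le d_{i,j}$, and unsatisfied otherwise. -}

module Defs where

open import Data.Nat using (ℕ; zero; suc; _∸_; _⊔_; _<_; _<?_)
open import Data.Fin using (Fin; toℕ)
open import Data.Fin.Permutation using (Permutation′; _⟨$⟩ʳ_)
open import Data.List using (List; foldr; map; filter; length; allFin; concatMap; _∷_; [])
open import Data.Product using (_×_; _,_)
open import Data.Sum using (_⊎_)
open import Relation.Binary.PropositionalEquality using (_≡_)

Deadlines : ℕ → ℕ → Set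
Deadlines n m = Fin n → Fin m → ℕ

dstar : ∀ {n m} → Deadlines n m → Fin m → ℕ
dstar {n} d j = foldr _⊔_ 0 (map (λ i → d i j) (allFin n))

-- Vertices of G (0-based indices):
--   v i j        ~ v_{i+1,j+1}
--   u j e        ~ u_{e+1,j+1}, e < d*_j
--   w i l        ~ w_{i+1,l+1}, l < m - k
data Vertex {n m : ℕ} (k : ℕ) (d : Deadlines n m) : Set where
  v : Fin n → Fin m → Vertex k d
  u : (j : Fin m) → Fin (dstar d j) → Vertex k d
  w : Fin n → Fin (m ∸ k) → Vertex k d

data Edge {n m : ℕ} {k : ℕ} {d : Deadlines n m} : Vertex k d → Vertex k d → Set where
  vw : ∀ i j l → Edge (v i j) (w i l)
  vu : ∀ i j (e : Fin (dstar d j)) → toℕ e < d i j → Edge (v i j) (u j e)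

Adj : ∀ {n m k} {d : Deadlines n m} → Vertex k d → Vertex k d → Set
Adj x y = Edge x y ⊎ Edge y x

endpoints : ∀ {A : Set} → List (A × A) → List A
endpoints [] = []
endpoints ((x , y) ∷ es) = x ∷ y ∷ endpoints es

-- Schedules: one permutation of the clients per day; completion time of client i
-- on day j is C_{i,j} = σ_j(i) (1-based).
Schedules : ℕ → ℕ → Set
Schedules n m = Fin m → Permutation′ n

completion : ∀ {n m} → Schedules n m → Fin n → Fin m → ℕ
completion σ i j = suc (toℕ (σ j ⟨$⟩ʳ i))

unsatCount : ∀ {n m} → Deadlines n m → Schedules n m → Fin n → ℕ
unsatCount {n} {m} d σ i =
  length (filter (λ j → d i j <? completion σ i j) (allFin m))

module Submission where

-- Every edge of G has exactly one endpoint in V and |V| = nm, so a matching of size nm is the same as an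
-- injective choice of a neighbour (a mate) for every v_{i,j}. Given schedules, an on-time job of
-- client i on day j takes u_{C_{i,j},j}, and the at most m - k late days of client i take distinct
-- w_{i,l}. Conversely, on day j order the clients by the index e of their mate u_{e,j}, clients
-- matched into W coming last: as mates are distinct, a client matched to u_{e,j} is preceded by
-- fewer than e others, so it meets its deadline d_{i,j} >= e; hence its late days are matched into
-- W, injectively, and there are at most m - k of them.

open import Defs
open import Data.Nat using (ℕ; suc; _+_; _*_; _∸_; _≤_; _<_; _⊔_; _<?_; s≤s)
open import Data.Nat.Properties
  using (1+n≰n; ≤-trans; <-trans; <-≤-trans; <-irrefl; <⇒≱; ≮⇒≥; <-cmp; m≤m⊔n; m≤n⊔m; m≤m+n; +-cancelˡ-≡)
open import Data.Fin using (Fin; toℕ; fromℕ<; inject≤; combine; remQuot)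
open import Data.Fin.Properties
  using ( injective⇒≤; _≟_; toℕ-injective; toℕ-fromℕ<; fromℕ<-injective; toℕ<n; inject≤-injective
        ; combine-injective; combine-remQuot)
open import Data.Fin.Permutation using (Permutation′; permutation; _⟨$⟩ʳ_; _⟨$⟩ˡ_; inverseˡ)
open import Data.List using (List; []; _∷_; _++_; map; filter; foldr; lookup; length; allFin)
open import Data.List.Properties using (length-map; length-tabulate; map-cong; map-∘; filter-notAll)
open import Data.List.Membership.Propositional using (_∈_)
open import Data.List.Membership.Propositional.Properties
  using (∈-lookup; ∈-map⁺; ∈-map⁻; ∈-allFin; ∈-filter⁺; ∈-filter⁻)
open import Data.List.Membership.Setoid.Properties using (index-injective)
open import Data.List.Relation.Unary.Any as Any using (here; there; any?)
open import Data.List.Relation.Unary.All as All using (All; []; _∷_)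
open import Data.List.Relation.Unary.All.Properties using (¬Any⇒All¬; ++⁻ˡ) renaming (map⁺ to All-map⁺)
open import Data.List.Relation.Unary.AllPairs using ([]; _∷_)
open import Data.List.Relation.Unary.Unique.Propositional using (Unique)
open import Data.List.Relation.Unary.Unique.Propositional.Properties using (map⁺; map⁻; allFin⁺; filter⁺; ++⁺)
open import Data.List.Relation.Binary.Disjoint.Propositional using (Disjoint)
open import Data.List.Relation.Binary.Permutation.Propositional using (_↭_; ↭-refl; prep; swap; ↭-trans; ↭-sym; ↭⇒↭ₛ)
open import Data.List.Relation.Binary.Permutation.Propositional.Properties using (shift)
import Data.List.Relation.Binary.Permutation.Setoid.Properties as Permutationₛ
open import Data.Product using (Σ; ∃; _×_; _,_; proj₁; proj₂; uncurry; map₁)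
open import Data.Product.Properties using (≡-dec; ×-≡,≡→≡)
open import Data.Sum using (_⊎_; inj₁; inj₂; [_,_])
open import Data.Empty using (⊥-elim)
open import Function using (_∘_; id)
open import Function.Bundles using (_⇔_; mk⇔)
open import Relation.Nullary using (Dec; yes; no; ¬_)
open import Relation.Binary.Definitions using (DecidableEquality; tri<; tri≈; tri>)
open import Relation.Binary.PropositionalEquality using (_≡_; _≢_; refl; sym; trans; cong; subst; setoid; module ≡-Reasoning)

lookup-injective : ∀ {A : Set} {xs : List A} → Unique xs →
                   ∀ {s t} → lookup xs s ≡ lookup xs t → s ≡ t
lookup-injective [] {()}
lookup-injective (_ ∷ _) {Fin.zero} {Fin.zero} _ = refl
lookup-injective (x∉ ∷ _) {Fin.zero} {Fin.suc t} eq = ⊥-elim (All.lookup x∉ (∈-lookup t) eq)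
lookup-injective (x∉ ∷ _) {Fin.suc s} {Fin.zero} eq = ⊥-elim (All.lookup x∉ (∈-lookup s) (sym eq))
lookup-injective (_ ∷ uniq) {Fin.suc s} {Fin.suc t} eq = cong Fin.suc (lookup-injective uniq eq)

length≤-of-injection : ∀ {A : Set} {xs : List A} {b} → Unique xs →
                       (f : ∀ {x} → x ∈ xs → Fin b) →
                       (∀ {x y} (p : x ∈ xs) (q : y ∈ xs) → f p ≡ f q → x ≡ y) →
                       length xs ≤ b
length≤-of-injection uniq f f-inj =
  injective⇒≤ (λ {s} {t} eq → lookup-injective uniq (f-inj (∈-lookup s) (∈-lookup t) eq))

∈-of-unique-length : ∀ {A : Set} {N} → DecidableEquality A →
                     (f : A → Fin N) → (∀ {x y} → f x ≡ f y → x ≡ y) →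
                     ∀ {xs} → Unique xs → length xs ≡ N → ∀ y → y ∈ xs
∈-of-unique-length {N = N} _≟ₐ_ f f-inj {xs} uniq len y with any? (y ≟ₐ_) xs
... | yes y∈xs = y∈xs
... | no  y∉xs = ⊥-elim (1+n≰n (subst (λ l → suc l ≤ N) len
                    (length≤-of-injection (¬Any⇒All¬ xs y∉xs ∷ uniq) (λ {x} _ → f x) (λ _ _ → f-inj))))

injective⇒permutation : ∀ {n} (f : Fin n → Fin n) → (∀ {x y} → f x ≡ f y → x ≡ y) → Permutation′ n
injective⇒permutation {n} f f-inj =
  permutation f (proj₁ ∘ preimage)
    (λ y → sym (proj₂ (proj₂ (preimage y))))
    (λ x → f-inj (sym (proj₂ (proj₂ (preimage (f x))))))
  where
  preimage : ∀ y → ∃ λ x → x ∈ allFin n × y ≡ f x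
  preimage = ∈-map⁻ f ∘ ∈-of-unique-length _≟_ id id (map⁺ f-inj (allFin⁺ n))
                          (trans (length-map f (allFin n)) (length-tabulate id))

permutation-injective : ∀ {n} (π : Permutation′ n) {x y} → π ⟨$⟩ʳ x ≡ π ⟨$⟩ʳ y → x ≡ y
permutation-injective π eq = trans (sym (inverseˡ π)) (trans (cong (π ⟨$⟩ˡ_) eq) (inverseˡ π))

Unique-map⇒injective : ∀ {A B : Set} {f : A → B} {xs} → Unique (map f xs) →
                       ∀ {x y} → x ∈ xs → y ∈ xs → f x ≡ f y → x ≡ y
Unique-map⇒injective _ (here refl) (here refl) _ = refl
Unique-map⇒injective {f = f} (fx∉ ∷ _) (here refl) (there y∈) eq =
  ⊥-elim (All.lookup fx∉ (∈-map⁺ f y∈) eq)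
Unique-map⇒injective {f = f} (fy∉ ∷ _) (there x∈) (here refl) eq =
  ⊥-elim (All.lookup fy∉ (∈-map⁺ f x∈) (sym eq))
Unique-map⇒injective (_ ∷ uniq) (there x∈) (there y∈) eq = Unique-map⇒injective uniq x∈ y∈ eq

Unique-++⁻ : ∀ {A : Set} (xs : List A) {ys} → Unique (xs ++ ys) → Unique xs × Unique ys
Unique-++⁻ [] uniq = [] , uniq
Unique-++⁻ (x ∷ xs) (x∉ ∷ uniq) = map₁ (++⁻ˡ xs x∉ ∷_) (Unique-++⁻ xs uniq)

Unique-resp-↭ : ∀ {A : Set} {xs ys : List A} → xs ↭ ys → Unique xs → Unique ys
Unique-resp-↭ {A} p = Permutationₛ.Unique-resp-↭ (setoid A) (↭⇒↭ₛ p)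

endpoints-map-↭ : ∀ {A B : Set} (f g : A → B) xs →
                  endpoints (map (λ x → f x , g x) xs) ↭ map f xs ++ map g xs
endpoints-map-↭ f g [] = ↭-refl
endpoints-map-↭ f g (x ∷ xs) =
  prep (f x) (↭-trans (prep (g x) (endpoints-map-↭ f g xs)) (↭-sym (shift (g x) (map f xs) (map g xs))))

∈⇒≤-foldr-⊔ : ∀ {x xs} → x ∈ xs → x ≤ foldr _⊔_ 0 xs
∈⇒≤-foldr-⊔ (here refl) = m≤m⊔n _ _
∈⇒≤-foldr-⊔ {xs = y ∷ _} (there x∈) = ≤-trans (∈⇒≤-foldr-⊔ x∈) (m≤n⊔m y _)

module Ranking {n : ℕ} (key : Fin n → ℕ) (key-injective : ∀ {i i'} → key i ≡ key i' → i ≡ i') where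

  below : Fin n → List (Fin n)
  below i = filter (λ i' → key i' <? key i) (allFin n)

  rank : Fin n → ℕ
  rank i = length (below i)

  private
    ∈-below⁻ : ∀ {i i'} → i' ∈ below i → key i' < key i
    ∈-below⁻ {i} = proj₂ ∘ ∈-filter⁻ (λ i' → key i' <? key i) {xs = allFin n}

    ∈-below⁺ : ∀ {i i'} → key i' < key i → i' ∈ below i
    ∈-below⁺ {i} {i'} = ∈-filter⁺ (λ i' → key i' <? key i) (∈-allFin i')

    below-unique : ∀ i → Unique (below i)
    below-unique i = filter⁺ _ (allFin⁺ n)

  rank<n : ∀ i → rank i < n
  rank<n i = subst (rank i <_) (length-tabulate id)
    (filter-notAll _ (allFin n) (Any.map (λ { refl → <-irrefl refl }) (∈-allFin i)))

  rank≤key : ∀ i → rank i ≤ key i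
  rank≤key i = length≤-of-injection (below-unique i) (λ p → fromℕ< (∈-below⁻ p))
    (λ p q → key-injective ∘ fromℕ<-injective _ _ (∈-below⁻ p) (∈-below⁻ q))

  rank-strictMono : ∀ {i i'} → key i < key i' → rank i < rank i'
  rank-strictMono {i} {i'} lt = length≤-of-injection
    (¬Any⇒All¬ _ (λ i∈ → <-irrefl refl (∈-below⁻ i∈)) ∷ below-unique i)
    (Any.index ∘ widen)
    (λ p q → index-injective (setoid (Fin n)) (widen p) (widen q))
    where
    widen : ∀ {x} → x ∈ i ∷ below i → x ∈ below i'
    widen (here refl) = ∈-below⁺ lt
    widen (there x∈)  = ∈-below⁺ (<-trans (∈-below⁻ x∈) lt)

  rank-injective : ∀ {i i'} → rank i ≡ rank i' → i ≡ i'
  rank-injective {i} {i'} eq with <-cmp (key i) (key i')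
  ... | tri< lt _ _ = ⊥-elim (<-irrefl eq (rank-strictMono lt))
  ... | tri≈ _ eq′ _ = key-injective eq′
  ... | tri> _ _ gt = ⊥-elim (<-irrefl (sym eq) (rank-strictMono gt))

  ranking : Permutation′ n
  ranking = injective⇒permutation (λ i → fromℕ< (rank<n i))
    (λ {i} {i'} → rank-injective ∘ fromℕ<-injective _ _ (rank<n i) (rank<n i'))

  ranking≤key : ∀ i → toℕ (ranking ⟨$⟩ʳ i) ≤ key i
  ranking≤key i = subst (_≤ key i) (sym (toℕ-fromℕ< (rank<n i))) (rank≤key i)

module EquitableScheduling {n m : ℕ} (k : ℕ) (d : Deadlines n m) where

  V : Set
  V = Vertex k d

  Matching : ℕ → Set
  Matching s = Σ (List (V × V)) λ M →
    All (λ e → Adj (proj₁ e) (proj₂ e)) M × Unique (endpoints M) × length M ≡ s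

  Neighbour : Fin n → Fin m → Set
  Neighbour i j = Σ V (Edge (v i j))

  EquitableSchedules : Set
  EquitableSchedules = Σ (Schedules n m) λ σ → ∀ i → unsatCount d σ i ≤ m ∸ k

  record SaturatingMatching : Set where
    field
      mate           : ∀ i j → Neighbour i j
      mate-injective : ∀ {i j i' j'} → proj₁ (mate i j) ≡ proj₁ (mate i' j') → (i , j) ≡ (i' , j')

  v-injective : ∀ {i j i' j'} → _≡_ {A = V} (v i j) (v i' j') → (i , j) ≡ (i' , j')
  v-injective refl = refl

  w-injective : ∀ {i i' l l'} → _≡_ {A = V} (w i l) (w i' l') → i ≡ i' × l ≡ l'
  w-injective refl = refl , refl

  u-injective : ∀ {j j'} {e : Fin (dstar d j)} {e' : Fin (dstar d j')} →
                _≡_ {A = V} (u j e) (u j' e') → j ≡ j' × toℕ e ≡ toℕ e'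
  u-injective refl = refl , refl

  neighbour≢v : ∀ {i j i' j'} (a : Neighbour i j) → proj₁ a ≢ v i' j'
  neighbour≢v (_ , vw _ _ _) ()
  neighbour≢v (_ , vu _ _ _ _) ()

  deadline≤dstar : ∀ i j → d i j ≤ dstar d j
  deadline≤dstar i j = ∈⇒≤-foldr-⊔ (∈-map⁺ (λ i → d i j) (∈-allFin i))

  saturating⇒matching : SaturatingMatching → Matching (n * m)
  saturating⇒matching S =
    map (λ t → left t , right t) (allFin (n * m)) ,
    All-map⁺ (All.universal (λ t → inj₁ (proj₂ (uncurry mate (cellAt t)))) _) ,
    Unique-resp-↭ (↭-sym (endpoints-map-↭ left right (allFin (n * m))))
      (++⁺ (map⁺ (cellAt-injective ∘ v-injective) (allFin⁺ _))
           (map⁺ (cellAt-injective ∘ mate-injective) (allFin⁺ _))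
           disjoint) ,
    trans (length-map _ (allFin (n * m))) (length-tabulate id)
    where
    open SaturatingMatching S

    cellAt : Fin (n * m) → Fin n × Fin m
    cellAt = remQuot m

    cellAt-injective : ∀ {t t'} → cellAt t ≡ cellAt t' → t ≡ t'
    cellAt-injective {t} {t'} eq =
      trans (sym (combine-remQuot {n} m t)) (trans (cong (uncurry combine) eq) (combine-remQuot {n} m t'))

    left right : Fin (n * m) → V
    left t = uncurry v (cellAt t)
    right t = proj₁ (uncurry mate (cellAt t))

    disjoint : Disjoint (map left (allFin (n * m))) (map right (allFin (n * m)))
    disjoint (x∈l , x∈r) with ∈-map⁻ left x∈l | ∈-map⁻ right x∈r
    ... | t , _ , refl | t' , _ , eq = neighbour≢v (uncurry mate (cellAt t')) (sym eq)

  Arc : Set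
  Arc = Σ (V × V) λ e → Edge (proj₁ e) (proj₂ e)

  head tail : Arc → V
  head = proj₁ ∘ proj₁
  tail = proj₂ ∘ proj₁

  source : Arc → Fin n × Fin m
  source (_ , vw i j _)   = i , j
  source (_ , vu i j _ _) = i , j

  head≡v-source : ∀ a → head a ≡ uncurry v (source a)
  head≡v-source (_ , vw _ _ _)   = refl
  head≡v-source (_ , vu _ _ _ _) = refl

  arc-neighbour : ∀ {i j} (a : Arc) → source a ≡ (i , j) → Edge (v i j) (tail a)
  arc-neighbour (_ , vw _ _ l)   refl = vw _ _ l
  arc-neighbour (_ , vu _ _ e p) refl = vu _ _ e p

  orient : ∀ {x y : V} → Adj x y → Arc
  orient (inj₁ e) = _ , e
  orient (inj₂ e) = _ , e

  orientAll : ∀ {M} → All (λ e → Adj (proj₁ e) (proj₂ e)) M → List Arc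
  orientAll []         = []
  orientAll (a ∷ adjs) = orient a ∷ orientAll adjs

  length-orientAll : ∀ {M} (adjs : All (λ e → Adj (proj₁ e) (proj₂ e)) M) →
                     length (orientAll adjs) ≡ length M
  length-orientAll []         = refl
  length-orientAll (_ ∷ adjs) = cong suc (length-orientAll adjs)

  endpoints-orientAll : ∀ {M} (adjs : All (λ e → Adj (proj₁ e) (proj₂ e)) M) →
                        endpoints M ↭ endpoints (map proj₁ (orientAll adjs))
  endpoints-orientAll []              = ↭-refl
  endpoints-orientAll (inj₁ _ ∷ adjs) = prep _ (prep _ (endpoints-orientAll adjs))
  endpoints-orientAll (inj₂ _ ∷ adjs) = swap _ _ (endpoints-orientAll adjs)

  matching⇒saturating : Matching (n * m) → SaturatingMatching
  matching⇒saturating (M , adjs , unique , size) = record { mate = mate ; mate-injective = mate-injective }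
    where
    arcs : List Arc
    arcs = orientAll adjs

    unique-ends : Unique (map head arcs) × Unique (map tail arcs)
    unique-ends = Unique-++⁻ (map head arcs)
      (Unique-resp-↭ (↭-trans (endpoints-orientAll adjs) (endpoints-map-↭ head tail arcs)) unique)

    unique-sources : Unique (map source arcs)
    unique-sources = map⁻ {f = uncurry v}
      (subst Unique (trans (map-cong head≡v-source arcs) (map-∘ arcs)) (proj₁ unique-ends))

    covered : ∀ p → p ∈ map source arcs
    covered = ∈-of-unique-length (≡-dec _≟_ _≟_) (uncurry combine)
      (λ {(i , j)} {(i' , j')} eq → ×-≡,≡→≡ (combine-injective i j i' j' eq)) unique-sources
      (trans (length-map source arcs) (trans (length-orientAll adjs) size))

    arcAt : Fin n × Fin m → Arc
    arcAt p = proj₁ (∈-map⁻ source (covered p))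

    arcAt∈arcs : ∀ p → arcAt p ∈ arcs
    arcAt∈arcs p = proj₁ (proj₂ (∈-map⁻ source (covered p)))

    source-arcAt : ∀ p → source (arcAt p) ≡ p
    source-arcAt p = sym (proj₂ (proj₂ (∈-map⁻ source (covered p))))

    mate : ∀ i j → Neighbour i j
    mate i j = tail (arcAt (i , j)) , arc-neighbour (arcAt (i , j)) (source-arcAt (i , j))

    mate-injective : ∀ {i j i' j'} → proj₁ (mate i j) ≡ proj₁ (mate i' j') → (i , j) ≡ (i' , j')
    mate-injective {i} {j} {i'} {j'} eq = begin
      (i , j)                   ≡⟨ sym (source-arcAt (i , j)) ⟩
      source (arcAt (i , j))    ≡⟨ cong source (Unique-map⇒injective (proj₂ unique-ends)
                                     (arcAt∈arcs (i , j)) (arcAt∈arcs (i' , j')) eq) ⟩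
      source (arcAt (i' , j'))  ≡⟨ source-arcAt (i' , j') ⟩
      (i' , j')                 ∎
      where open ≡-Reasoning

  slotKey : ∀ {i j} → Neighbour i j → ℕ
  slotKey         (_ , vu _ _ e _) = toℕ e
  slotKey {i} {j} (_ , vw _ _ _)   = dstar d j + toℕ i

  slot≢spareKey : ∀ {i : Fin n} {j} (e : Fin (dstar d j)) → toℕ e ≢ dstar d j + toℕ i
  slot≢spareKey {i} {j} e eq = <-irrefl eq (<-≤-trans (toℕ<n e) (m≤m+n (dstar d j) (toℕ i)))

  slotKey-injective : ∀ {i i' j} (a : Neighbour i j) (a' : Neighbour i' j) →
                      slotKey a ≡ slotKey a' → i ≡ i' ⊎ proj₁ a ≡ proj₁ a'
  slotKey-injective {j = j} (_ , vu _ _ _ _) (_ , vu _ _ _ _) eq = inj₂ (cong (u j) (toℕ-injective eq))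
  slotKey-injective (_ , vu _ _ e _) (_ , vw _ _ _)    eq = ⊥-elim (slot≢spareKey e eq)
  slotKey-injective (_ , vw _ _ _)   (_ , vu _ _ e _)  eq = ⊥-elim (slot≢spareKey e (sym eq))
  slotKey-injective {i} {i'} {j} (_ , vw _ _ _) (_ , vw _ _ _) eq =
    inj₁ (toℕ-injective (+-cancelˡ-≡ (dstar d j) (toℕ i) (toℕ i') eq))

  late⇒spare : ∀ {i j r} (a : Neighbour i j) → r ≤ slotKey a → d i j < suc r →
               ∃ λ l → proj₁ a ≡ w i l
  late⇒spare (_ , vw _ _ l)     _   _    = l , refl
  late⇒spare (_ , vu _ _ _ e<d) r≤e late = ⊥-elim (<⇒≱ late (≤-trans (s≤s r≤e) e<d))

  saturating⇒schedules : SaturatingMatching → EquitableSchedules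
  saturating⇒schedules S = σ , fair
    where
    open SaturatingMatching S

    key : Fin m → Fin n → ℕ
    key j i = slotKey (mate i j)

    key-injective : ∀ {j i i'} → key j i ≡ key j i' → i ≡ i'
    key-injective {j} {i} {i'} eq =
      [ id , cong proj₁ ∘ mate-injective ] (slotKey-injective (mate i j) (mate i' j) eq)

    σ : Schedules n m
    σ j = Ranking.ranking (key j) key-injective

    spare : ∀ {i j} → d i j < completion σ i j → ∃ λ l → proj₁ (mate i j) ≡ w i l
    spare {i} {j} = late⇒spare (mate i j) (Ranking.ranking≤key (key j) key-injective i)

    fair : ∀ i → unsatCount d σ i ≤ m ∸ k
    fair i = length≤-of-injection (filter⁺ _ (allFin⁺ m)) (λ p → proj₁ (spare (late p)))
      (λ p q eq → cong proj₂ (mate-injective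
        (trans (proj₂ (spare (late p))) (trans (cong (w i) eq) (sym (proj₂ (spare (late q))))))))
      where
      late : ∀ {j} → j ∈ filter (λ j → d i j <? completion σ i j) (allFin m) → d i j < completion σ i j
      late = proj₂ ∘ ∈-filter⁻ (λ j → d i j <? completion σ i j) {xs = allFin m}

  schedules⇒saturating : EquitableSchedules → SaturatingMatching
  schedules⇒saturating (σ , fair) = record
    { mate           = λ i j → mateFor (late? i j)
    ; mate-injective = λ {i} {j} {i'} {j'} → mateFor-injective (late? i j) (late? i' j')
    }
    where
    late? : ∀ i j → Dec (d i j < completion σ i j)
    late? i j = d i j <? completion σ i j

    spareSlot : ∀ {i j} → d i j < completion σ i j → Fin (m ∸ k)
    spareSlot {i} {j} late = inject≤ (Any.index (∈-filter⁺ (late? i) (∈-allFin j) late)) (fair i)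

    onTime⇒slot : ∀ {i j} → ¬ d i j < completion σ i j → toℕ (σ j ⟨$⟩ʳ i) < dstar d j
    onTime⇒slot {i} {j} onTime = <-≤-trans (≮⇒≥ onTime) (deadline≤dstar i j)

    mateFor : ∀ {i j} → Dec (d i j < completion σ i j) → Neighbour i j
    mateFor {i} {j} (yes late)  = w i (spareSlot late) , vw i j _
    mateFor {i} {j} (no onTime) = u j (fromℕ< (onTime⇒slot onTime)) ,
      vu i j _ (subst (_< d i j) (sym (toℕ-fromℕ< (onTime⇒slot onTime))) (≮⇒≥ onTime))

    mateFor-injective : ∀ {i j i' j'} (x : Dec (d i j < completion σ i j))
                        (x' : Dec (d i' j' < completion σ i' j')) →
                        proj₁ (mateFor x) ≡ proj₁ (mateFor x') → (i , j) ≡ (i' , j')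
    mateFor-injective {i} (yes late) (yes late') eq with w-injective eq
    ... | refl , l≡l' = cong (i ,_) (index-injective (setoid (Fin m)) _ _ (inject≤-injective _ _ _ _ l≡l'))
    mateFor-injective {i} {j} {i'} (no onTime) (no onTime') eq with u-injective eq
    ... | refl , e≡e' = cong (_, j) (permutation-injective (σ j)
      (toℕ-injective (fromℕ<-injective _ _ (onTime⇒slot onTime) (onTime⇒slot onTime')
                                         (toℕ-injective e≡e'))))
    mateFor-injective (yes _) (no _) ()
    mateFor-injective (no _) (yes _) ()

lemma1 : (n m k : ℕ) → (d : Deadlines n m) →
    (∀ i j → 0 < d i j) → k ≤ m →
    (Σ (List (Vertex k d × Vertex k d)) (λ M →
        All (λ e → Adj (proj₁ e) (proj₂ e)) M × Unique (endpoints M) × length M ≡ n * m))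
    ⇔ Σ (Schedules n m) (λ σ → ∀ i → unsatCount d σ i ≤ m ∸ k)
lemma1 n m k d _ _ =
  mk⇔ (saturating⇒schedules ∘ matching⇒saturating) (saturating⇒matching ∘ schedules⇒saturating)
  where open EquitableScheduling k d
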